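{- Let $\mathbf T$ be a nominal transition system with a nominal set $\mathcal F$ of effects and an equivariant function $L\colon\mathrm{ACT}_{\mathbf T}\times\mathcal P_{\mathrm{fs}}(\mathcal F)\times\mathcal F\to\mathcal P_{\mathrm{fs}}(\mathcal F)$, and let $L(\mathbf T)$ be its $L$-transform. For all $F\in\mathcal P_{\mathrm{fs}}(\mathcal F)$ and states $P,Q$ of $\mathbf T$: if $\mathrm{EF}(F,P)\stackrel{\cdot}{\sim}\mathrm{EF}(F,Q)$ in $L(\mathbf T)$, then $P\stackrel{F/L}{\sim}Q$ in $\mathbf T$.
   Context: Nominal sets over a countably infinite (possibly sorted) set of names $\mathcal N$: permutations fix all but finitely many names; every element has finite support $\operatorname{supp}$; $a\# X$ means $a\notin\operatorname{supp}(X)$; $N\# X,Y$ means every $a\in N$ is fresh for $X$ and $Y$; $[\mathcal P_{\mathrm{fin}}(\mathcal N)]S$ is $\mathcal P_{\mathrm{fin}}(\mathcal N)\times S$ modulo $(N,X)=_\alpha(N',X')$ iff some $\pi$ with $\pi\cdot(N,X)=(N',X')$ fixes every name of $\operatorname{supp}(X)\setminus N$; classes $\langle N\rangle X$. A nominal transition system: nominal sets STATES, PRED, ACT; equivariant $\vdash\subseteq\mathrm{STATES}\times\mathrm{PRED}$; equivariant $\operatorname{bn}$, $\operatorname{bn}(\alpha)$ a finite subset of $\operatorname{supp}(\alpha)$; equivariant $\rightarrow\ \subseteq\mathrm{STATES}\times[\mathcal P_{\mathrm{fin}}(\mathcal N)](\mathrm{ACT}\times\mathrm{STATES})$ with $(P,\langle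 N\rangle(\alpha,Q))\in\rightarrow$ only if $N=\operatorname{bn}(\alpha)$; $P\xrightarrow{\alpha}P'$ means $(P,\langle\operatorname{bn}(\alpha)\rangle(\alpha,P'))\in\rightarrow$. A bisimulation is a symmetric relation $R$ on states with: $R(P,Q)$ implies (1) $P\vdash\varphi\Rightarrow Q\vdash\varphi$ for all $\varphi$; (2) whenever $\operatorname{bn}(\alpha)\# Q$ and $P\xrightarrow{\alpha}P'$ there is $Q'$ with $Q\xrightarrow{\alpha}Q'$ and $R(P',Q')$. $\stackrel{\cdot}{\sim}$ is the union of all bisimulations. An effect is a finitely supported function from states to states; $\mathcal F$ is a nominal set of effects; $\mathcal P_{\mathrm{fs}}(\mathcal F)$ its finitely supported subsets. An $L$-bisimulation is a family $\{R_F\}_{F\in\mathcal P_{\mathrm{fs}}(\mathcal F)}$ of symmetric relations on states with: $R_F(P,Q)$ implies (1) for all $f\in F$, $\varphi$: $f(P)\vdash\varphi\Rightarrow f(Q)\vdash\varphi$; (2) for all $f\in F$, $\alpha,P'$ with $\operatorname{bn}(\alpha)\# f(Q),F,f$: if $f(P)\xrightarrow{\alpha}P'$ then some $Q'$ has $f(Q)\xrightarrow{\alpha}Q'$ and $R_{L(\alpha,F,f)}(P',Q')$. $P\stackrel{F/L}{\sim}Q$ iff some $L$-bisimulation has $R_F(P,Q)$. The $L$-transform $L(\mathbf T)$ is the nominal transition system with: states $\mathrm{AC}(f,F,P)$ ($f\in\mathcal F$, $F\in\mathcal P_{\mathrm{fs}}(\mathcal F)$, $P\in\mathrm{STATES}_{\mathbf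 T}$) and $\mathrm{EF}(F,P)$ ($F\in\mathcal P_{\mathrm{fs}}(\mathcal F)$, $P\in\mathrm{STATES}_{\mathbf T}$), permutations acting componentwise; predicates $\mathrm{PRED}_{\mathbf T}$ with $\mathrm{AC}(f,F,P)\vdash\varphi$ iff $P\vdash_{\mathbf T}\varphi$ and $\mathrm{EF}(F,P)\vdash\varphi$ never; actions $\mathrm{ACT}_{\mathbf T}\uplus\mathcal F$, with $\operatorname{bn}$ as in $\mathbf T$ on $\mathrm{ACT}_{\mathbf T}$ and $\operatorname{bn}(f)=\emptyset$ for $f\in\mathcal F$; transitions: $\mathrm{AC}(f,F,P)\xrightarrow{\alpha}\mathrm{EF}(L(\alpha,F,f),P')$ whenever $P\xrightarrow{\alpha}P'$ in $\mathbf T$ with $\operatorname{bn}(\alpha)\# f,F$, and $\mathrm{EF}(F,P)\xrightarrow{f}\mathrm{AC}(f,F,f(P))$ for each $f\in F$. -}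

module Defs where

open import Data.Nat using (ℕ)
open import Data.List using (List; []; _++_; map)
open import Data.List.Membership.Propositional using (_∈_; _∉_)
open import Data.List.Membership.Propositional.Properties using (∈-++⁺ˡ; ∈-++⁺ʳ)
open import Data.Product using (Σ; ∃; ∃-syntax; _×_; _,_; proj₁; proj₂)
open import Data.Sum using (_⊎_; inj₁; inj₂)
open import Data.Empty using (⊥)
open import Relation.Nullary using (¬_)
open import Relation.Binary.PropositionalEquality using (_≡_; _≢_; refl; sym; trans; cong)
open import Function using (id; _∘_)
open import Function.Bundles using (_⇔_)

-- Names: ℕ (a countably infinite set), with a sorting in which every
-- sort has infinitely many names.  The unsorted case is Sort = ⊤.

record Sorting : Set₁ where
  field
    Sort     : Set
    sort     : ℕ → Sort
    infinite : (s : Sort) (xs : List ℕ) → ∃[ a ] (sort a ≡ s × a ∉ xs)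

record Perm (S : Sorting) : Set where
  field
    fun       : ℕ → ℕ
    inv       : ℕ → ℕ
    inv-l     : ∀ a → inv (fun a) ≡ a
    inv-r     : ∀ a → fun (inv a) ≡ a
    sort-pres : ∀ a → Sorting.sort S (fun a) ≡ Sorting.sort S a
    dom       : List ℕ
    finite    : ∀ a → a ∉ dom → fun a ≡ a

open Perm public using (fun)

idP : ∀ {S} → Perm S
idP = record
  { fun = id ; inv = id ; inv-l = λ _ → refl ; inv-r = λ _ → refl
  ; sort-pres = λ _ → refl ; dom = [] ; finite = λ _ _ → refl }

_∘P_ : ∀ {S} → Perm S → Perm S → Perm S
π ∘P σ = record
  { fun = Perm.fun π ∘ Perm.fun σ
  ; inv = Perm.inv σ ∘ Perm.inv π
  ; inv-l = λ a → trans (cong (Perm.inv σ) (Perm.inv-l π (Perm.fun σ a))) (Perm.inv-l σ a)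
  ; inv-r = λ a → trans (cong (Perm.fun π) (Perm.inv-r σ (Perm.inv π a))) (Perm.inv-r π a)
  ; sort-pres = λ a → trans (Perm.sort-pres π (Perm.fun σ a)) (Perm.sort-pres σ a)
  ; dom = Perm.dom π ++ Perm.dom σ
  ; finite = λ a a∉ → trans (cong (Perm.fun π) (Perm.finite σ a (λ m → a∉ (∈-++⁺ʳ (Perm.dom π) m))))
                            (Perm.finite π a (λ m → a∉ (∈-++⁺ˡ m)))
  }

-- Support and freshness, generically over a relation
--   R π x y   meaning   "y = π · x"
-- (so that sets whose natural equality is not _≡_, e.g. subsets given
-- by predicates, can be handled with their extensional equality).

FixesAll : ∀ {S} → Perm S → List ℕ → Set
FixesAll π A = ∀ a → a ∈ A → fun π a ≡ a

SupportedBy : ∀ {S : Sorting} {ℓ r} {X : Set ℓ} → (Perm S → X → X → Set r) → List ℕ → X → Set r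
SupportedBy {S} R A x = (π : Perm S) → FixesAll π A → R π x x

FreshBy : ∀ {S : Sorting} {ℓ r} {X : Set ℓ} → (Perm S → X → X → Set r) → ℕ → X → Set r
FreshBy R a x = ∃[ A ] (a ∉ A × SupportedBy R A x)

SameSet : List ℕ → List ℕ → Set
SameSet N M = ∀ a → (a ∈ N ⇔ a ∈ M)

-- (N , x) =α (N' , x') : some π with π·(N,x) = (N',x') fixing every name
-- of supp(x) ∖ N.  The last clause is written contrapositively:
-- a ∉ N and π a ≠ a imply a ∉ supp(x).
AlphaEqBy : ∀ {S : Sorting} {ℓ r} {X : Set ℓ} → (Perm S → X → X → Set r) →
            List ℕ → X → List ℕ → X → Set r
AlphaEqBy {S} R N x N' x' =
  Σ (Perm S) λ π → SameSet (map (fun π) N) N' × R π x x' ×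
                   (∀ a → a ∉ N → fun π a ≢ a → FreshBy R a x)

record Nominal (S : Sorting) (X : Set) : Set where
  field
    act     : Perm S → X → X
    act-id  : ∀ x → act idP x ≡ x
    act-∘   : ∀ π σ x → act (π ∘P σ) x ≡ act π (act σ x)
    act-ext : ∀ π σ → (∀ a → fun π a ≡ fun σ a) → ∀ x → act π x ≡ act σ x
    fin-supp : ∀ x → ∃[ A ] SupportedBy (λ π y z → act π y ≡ z) A x

ActR : ∀ {S X} → Nominal S X → Perm S → X → X → Set
ActR N π x y = Nominal.act N π x ≡ y

Fresh : ∀ {S X} → Nominal S X → ℕ → X → Set
Fresh N = FreshBy (ActR N)

PairR : ∀ {S X Y} → Nominal S X → Nominal S Y → Perm S → X × Y → X × Y → Set
PairR NX NY π (x , y) (x' , y') = ActR NX π x x' × ActR NY π y y'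

-- A transition (P , ⟨bn α⟩(α , P')) is
-- represented by  P ⟶[ α ] P' ; the relation is closed under
-- α-equivalence of the abstraction, i.e. it is a relation on
-- STATES × [P_fin(N)](ACT × STATES).

record NTS (S : Sorting) : Set₁ where
  field
    STATES PRED ACT : Set
    nomS : Nominal S STATES
    nomP : Nominal S PRED
    nomA : Nominal S ACT
    _⊢_  : STATES → PRED → Set
    ⊢-eqv : ∀ π P φ → P ⊢ φ → Nominal.act nomS π P ⊢ Nominal.act nomP π φ
    bn    : ACT → List ℕ
    bn-eqv : ∀ π α → SameSet (bn (Nominal.act nomA π α)) (map (fun π) (bn α))
    bn-supp : ∀ α a → a ∈ bn α → ¬ Fresh nomA a α
    _⟶[_]_ : STATES → ACT → STATES → Set
    ⟶-eqv : ∀ π P α P' → P ⟶[ α ] P' →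
            Nominal.act nomS π P ⟶[ Nominal.act nomA π α ] Nominal.act nomS π P'
    ⟶-α   : ∀ P α P' α' P'' →
            AlphaEqBy (PairR nomA nomS) (bn α) (α , P') (bn α') (α' , P'') →
            P ⟶[ α ] P' → P ⟶[ α' ] P''

-- A nominal set of effects: elements of 𝓕 are finitely supported
-- functions STATES → STATES (app is injective = extensional), and the
-- action on 𝓕 is the conjugation action on functions.

record Effects {S : Sorting} (T : NTS S) : Set₁ where
  open NTS T
  field
    𝓕      : Set
    nomF    : Nominal S 𝓕
    app     : 𝓕 → STATES → STATES
    app-eqv : ∀ π f P → app (Nominal.act nomF π f) (Nominal.act nomS π P) ≡ Nominal.act nomS π (app f P)
    app-ext : ∀ f g → (∀ P → app f P ≡ app g P) → f ≡ g

module Eff {S : Sorting} (T : NTS S) (E : Effects T) where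
  open NTS T
  open Effects E

  IsActP : Perm S → (𝓕 → Set) → (𝓕 → Set) → Set
  IsActP π G H = ∀ f → (H (Nominal.act nomF π f) ⇔ G f)

  record PFS : Set₁ where
    field
      mem : 𝓕 → Set
      fs  : ∃[ A ] SupportedBy IsActP A mem

  open PFS public

  FreshPFS : ℕ → PFS → Set
  FreshPFS a F = FreshBy IsActP a (mem F)

  record LMap : Set₁ where
    field
      L     : ACT → PFS → 𝓕 → PFS
      L-eqv : ∀ π α F G f → IsActP π (mem F) (mem G) →
              IsActP π (mem (L α F f)) (mem (L (Nominal.act nomA π α) G (Nominal.act nomF π f)))

module Transform {S : Sorting} (T : NTS S) (E : Effects T) (Lm : Eff.LMap T E) where
  open NTS T
  open Effects E
  open Eff T E
  open LMap Lm

  data LState : Set₁ where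
    AC : 𝓕 → PFS → STATES → LState
    EF : PFS → STATES → LState

  LActR : Perm S → LState → LState → Set
  LActR π (AC f F P) (AC f' F' P') =
    Nominal.act nomF π f ≡ f' × IsActP π (mem F) (mem F') × Nominal.act nomS π P ≡ P'
  LActR π (EF F P) (EF F' P') = IsActP π (mem F) (mem F') × Nominal.act nomS π P ≡ P'
  LActR π _ _ = ⊥

  LACT : Set
  LACT = ACT ⊎ 𝓕

  LActAR : Perm S → LACT → LACT → Set
  LActAR π (inj₁ α) (inj₁ α') = Nominal.act nomA π α ≡ α'
  LActAR π (inj₂ f) (inj₂ f') = Nominal.act nomF π f ≡ f'
  LActAR π _ _ = ⊥

  bnL : LACT → List ℕ
  bnL (inj₁ α) = bn α
  bnL (inj₂ f) = []

  LPairR : Perm S → LACT × LState → LACT × LState → Set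
  LPairR π (β , s) (β' , s') = LActAR π β β' × LActR π s s'

  _⊢L_ : LState → PRED → Set
  AC f F P ⊢L φ = P ⊢ φ
  EF F P   ⊢L φ = ⊥

  data LGen : LState → LACT → LState → Set₁ where
    ac : ∀ {f F P α P'} → P ⟶[ α ] P' →
         (∀ a → a ∈ bn α → Fresh nomF a f × FreshPFS a F) →
         LGen (AC f F P) (inj₁ α) (EF (L α F f) P')
    ef : ∀ {F P f} → mem F f → LGen (EF F P) (inj₂ f) (AC f F (app f P))

  -- s ⟶L[ β ] s'  iff  (s , ⟨bnL β⟩(β , s')) is (α-equivalent to) a generating transition
  _⟶L[_]_ : LState → LACT → LState → Set₁
  s ⟶L[ β ] s' = ∃[ β₀ ] ∃[ s₀ ] (LGen s β₀ s₀ × AlphaEqBy LPairR (bnL β₀) (β₀ , s₀) (bnL β) (β , s'))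

  IsBisimL : (LState → LState → Set₁) → Set₁
  IsBisimL R =
    (∀ s t → R s t → R t s) ×
    (∀ s t → R s t →
       (∀ φ → s ⊢L φ → t ⊢L φ) ×
       (∀ β s' → (∀ a → a ∈ bnL β → FreshBy LActR a t) → s ⟶L[ β ] s' →
          ∃[ t' ] (t ⟶L[ β ] t' × R s' t')))

  _∼L_ : LState → LState → Set₂
  s ∼L t = ∃[ R ] (IsBisimL R × R s t)

  IsLBisim : (PFS → STATES → STATES → Set₂) → Set₂
  IsLBisim R =
    (∀ F P Q → R F P Q → R F Q P) ×
    (∀ F P Q → R F P Q →
       (∀ f → mem F f → ∀ φ → app f P ⊢ φ → app f Q ⊢ φ) ×
       (∀ f → mem F f → ∀ α P' →
          (∀ a → a ∈ bn α → Fresh nomS a (app f Q) × FreshPFS a F × Fresh nomF a f) →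
          app f P ⟶[ α ] P' →
          ∃[ Q' ] (app f Q ⟶[ α ] Q' × R (L α F f) P' Q')))

  _∼[_/L]_ : STATES → PFS → STATES → Set₃
  P ∼[ F /L] Q = ∃[ R ] (IsLBisim R × R F P Q)

module Submission where

-- The witnessing L-bisimulation relates P and Q at F whenever EF(G₁,P) and
-- EF(G₂,Q) are bisimilar in L(T) for some G₁, G₂ extensionally equal to F
-- (subsets of effects are predicates, so F is only determined up to ≈).
-- Its transfer property comes from playing the L(T)-bisimulation game
-- twice: an effect step EF → AC, then an action step AC → EF.

open import Defs
open import Data.Nat using (ℕ; _≟_)
open import Data.List using (List; []; _∷_; _++_; map)
open import Data.List.Properties using (++-identityʳ; map-id)
open import Data.List.Membership.Propositional using (_∈_; _∉_)
open import Data.List.Membership.Propositional.Properties using (∈-++⁺ˡ; ∈-++⁺ʳ; ∈-++⁻; ∈-map⁺)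
open import Data.List.Relation.Binary.Permutation.Propositional using (↭-sym)
open import Data.List.Relation.Binary.Permutation.Propositional.Properties using (∈-resp-↭; shift)
open import Data.List.Relation.Unary.Any using (here; there)
open import Data.Product using (∃-syntax; _×_; _,_; proj₁; proj₂)
open import Data.Sum using (_⊎_; inj₁; inj₂)
open import Data.Empty using (⊥-elim)
open import Level using (0ℓ)
open import Relation.Nullary using (Dec; yes; no)
open import Relation.Binary.PropositionalEquality
  using (_≡_; _≢_; refl; sym; trans; cong; cong₂; subst; subst₂; module ≡-Reasoning)
open import Relation.Binary.Structures using (IsEquivalence)
open import Function using (_∘_)
open import Function.Bundles using (_⇔_; Equivalence)
open import Function.Properties.Equivalence using (⇔-isEquivalence)

open IsEquivalence (⇔-isEquivalence {ℓ = 0ℓ}) using ()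
  renaming (refl to ⇔-refl; sym to ⇔-sym; trans to ⇔-trans)

data SwapView (a c x : ℕ) : Set where
  at-a  : x ≡ a → SwapView a c x
  at-c  : x ≢ a → x ≡ c → SwapView a c x
  other : x ≢ a → x ≢ c → SwapView a c x

swapView : ∀ a c x → SwapView a c x
swapView a c x with x ≟ a | x ≟ c
... | yes x≡a | _       = at-a x≡a
... | no x≢a  | yes x≡c = at-c x≢a x≡c
... | no x≢a  | no x≢c  = other x≢a x≢c

swap : ℕ → ℕ → ℕ → ℕ
swap a c x with swapView a c x
... | at-a _    = c
... | at-c _ _  = a
... | other _ _ = x

swap-a : ∀ a c → swap a c a ≡ c
swap-a a c with swapView a c a
... | at-a _       = refl
... | at-c a≢a _   = ⊥-elim (a≢a refl)
... | other a≢a _  = ⊥-elim (a≢a refl)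

swap-c : ∀ a c → swap a c c ≡ a
swap-c a c with swapView a c c
... | at-a c≡a     = c≡a
... | at-c _ _     = refl
... | other _ c≢c  = ⊥-elim (c≢c refl)

swap-other : ∀ a c x → x ≢ a → x ≢ c → swap a c x ≡ x
swap-other a c x x≢a x≢c with swapView a c x
... | at-a x≡a     = ⊥-elim (x≢a x≡a)
... | at-c _ x≡c   = ⊥-elim (x≢c x≡c)
... | other _ _    = refl

swap-involutive : ∀ a c x → swap a c (swap a c x) ≡ x
swap-involutive a c x = by-cases (swapView a c x)
  where
  by-cases : SwapView a c x → swap a c (swap a c x) ≡ x
  by-cases (at-a refl)         = trans (cong (swap a c) (swap-a a c)) (swap-c a c)
  by-cases (at-c _ refl)       = trans (cong (swap a c) (swap-c a c)) (swap-a a c)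
  by-cases (other x≢a x≢c)     =
    trans (cong (swap a c) (swap-other a c x x≢a x≢c)) (swap-other a c x x≢a x≢c)

swap-moves : ∀ a c x → swap a c x ≢ x → x ≡ a ⊎ x ≡ c
swap-moves a c x moved = by-cases (swapView a c x)
  where
  by-cases : SwapView a c x → x ≡ a ⊎ x ≡ c
  by-cases (at-a x≡a)      = inj₁ x≡a
  by-cases (at-c _ x≡c)    = inj₂ x≡c
  by-cases (other x≢a x≢c) = ⊥-elim (moved (swap-other a c x x≢a x≢c))

swap-preserves : ∀ {p} (P : ℕ → Set p) a c x → P a → P c → P x → P (swap a c x)
swap-preserves P a c x Pa Pc Px = by-cases (swapView a c x)
  where
  by-cases : SwapView a c x → P (swap a c x)
  by-cases (at-a x≡a)      = subst P (sym (trans (cong (swap a c) x≡a) (swap-a a c))) Pc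
  by-cases (at-c _ x≡c)    = subst P (sym (trans (cong (swap a c) x≡c) (swap-c a c))) Pa
  by-cases (other x≢a x≢c) = subst P (sym (swap-other a c x x≢a x≢c)) Px

module Permutations (S : Sorting) where
  open Sorting S

  transposition : (a c : ℕ) → sort a ≡ sort c → Perm S
  transposition a c same-sort = record
    { fun = swap a c ; inv = swap a c
    ; inv-l = swap-involutive a c ; inv-r = swap-involutive a c
    ; sort-pres = sort-pres ; dom = a ∷ c ∷ []
    ; finite = λ x x∉ → swap-other a c x (x∉ ∘ here) (x∉ ∘ there ∘ here) }
    where
    sort-pres : ∀ x → sort (swap a c x) ≡ sort x
    sort-pres x = by-cases (swapView a c x)
      where
      by-cases : SwapView a c x → sort (swap a c x) ≡ sort x
      by-cases (at-a refl)     = trans (cong sort (swap-a a c)) (sym same-sort)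
      by-cases (at-c _ refl)   = trans (cong sort (swap-c a c)) same-sort
      by-cases (other x≢a x≢c) = cong sort (swap-other a c x x≢a x≢c)

  inverse : Perm S → Perm S
  inverse π = record
    { fun = Perm.inv π ; inv = fun π ; inv-l = Perm.inv-r π ; inv-r = Perm.inv-l π
    ; sort-pres = λ a → sym (trans (cong sort (sym (Perm.inv-r π a)))
                                   (Perm.sort-pres π (Perm.inv π a)))
    ; dom = Perm.dom π
    ; finite = λ a a∉ → trans (cong (Perm.inv π) (sym (Perm.finite π a a∉))) (Perm.inv-l π a) }

  fun-injective : ∀ (π : Perm S) {a b} → fun π a ≡ fun π b → a ≡ b
  fun-injective π {a} {b} πa≡πb =
    trans (sym (Perm.inv-l π a)) (trans (cong (Perm.inv π) πa≡πb) (Perm.inv-l π b))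

  record Coherent {ℓ r} {X : Set ℓ} (R : Perm S → X → X → Set r) (x : X) : Set r where
    field
      compose : ∀ π σ → R π x x → R σ x x → R (π ∘P σ) x x
      extensional : ∀ π σ → (∀ a → fun π a ≡ fun σ a) → R π x x → R σ x x

  module Support {ℓ r} {X : Set ℓ} (R : Perm S → X → X → Set r) (x : X)
                 (coherent : Coherent R x) where
    open Coherent coherent

    -- If π moves
    -- a, conjugating π by (a c) for a completely fresh c yields a
    -- permutation fixing the old support; undoing the conjugation costs
    -- only (a c), which fixes x because both names are fresh.
    drop-fresh : ∀ {A A' a} → SupportedBy R A x → FreshBy R a x →
                 (∀ b → b ∈ A → b ≢ a → b ∈ A') → SupportedBy R A' x
    drop-fresh {A} {A'} {a} supA (B , a∉B , supB) A∖a⊆A' π fixesA' with fun π a ≟ a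
    ... | yes πa≡a = supA π fixesA
      where
      fixesA : FixesAll π A
      fixesA b b∈A with b ≟ a
      ... | yes refl = πa≡a
      ... | no b≢a   = fixesA' b (A∖a⊆A' b b∈A b≢a)
    ... | no _ =
      extensional (τ ∘P (ρ ∘P τ)) π undo-conjugation
        (compose τ (ρ ∘P τ) τ-fixes-x (compose ρ τ ρ-fixes-x τ-fixes-x))
      where
      choice = infinite (sort a) (a ∷ A ++ B ++ Perm.dom π)
      c = proj₁ choice
      c∉ : c ∉ a ∷ A ++ B ++ Perm.dom π
      c∉ = proj₂ (proj₂ choice)
      c∉A : c ∉ A
      c∉A = c∉ ∘ there ∘ ∈-++⁺ˡ
      c∉B : c ∉ B
      c∉B = c∉ ∘ there ∘ ∈-++⁺ʳ A ∘ ∈-++⁺ˡ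
      πc≡c : fun π c ≡ c
      πc≡c = Perm.finite π c (c∉ ∘ there ∘ ∈-++⁺ʳ A ∘ ∈-++⁺ʳ B)
      τ = transposition a c (sym (proj₁ (proj₂ choice)))
      ρ = τ ∘P (π ∘P τ)
      τ-fixes-x : R τ x x
      τ-fixes-x = supB τ λ b b∈B →
        swap-other a c b (λ b≡a → a∉B (subst (_∈ B) b≡a b∈B))
                         (λ b≡c → c∉B (subst (_∈ B) b≡c b∈B))
      ρ-fixes-a : fun ρ a ≡ a
      ρ-fixes-a = begin
        swap a c (fun π (swap a c a))  ≡⟨ cong (swap a c ∘ fun π) (swap-a a c) ⟩
        swap a c (fun π c)             ≡⟨ cong (swap a c) πc≡c ⟩
        swap a c c                     ≡⟨ swap-c a c ⟩
        a                              ∎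
        where open ≡-Reasoning
      ρ-fixes-A : FixesAll ρ A
      ρ-fixes-A b b∈A = by-cases (b ≟ a)
        where
        by-cases : Dec (b ≡ a) → fun ρ b ≡ b
        by-cases (yes b≡a) = subst (λ y → fun ρ y ≡ y) (sym b≡a) ρ-fixes-a
        by-cases (no b≢a)  = begin
          swap a c (fun π (swap a c b))  ≡⟨ cong (swap a c ∘ fun π) τb≡b ⟩
          swap a c (fun π b)             ≡⟨ cong (swap a c) (fixesA' b (A∖a⊆A' b b∈A b≢a)) ⟩
          swap a c b                     ≡⟨ τb≡b ⟩
          b                              ∎
          where
          open ≡-Reasoning
          τb≡b : swap a c b ≡ b
          τb≡b = swap-other a c b b≢a (λ b≡c → c∉A (subst (_∈ A) b≡c b∈A))
      ρ-fixes-x : R ρ x x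
      ρ-fixes-x = supA ρ ρ-fixes-A
      undo-conjugation : ∀ y → fun (τ ∘P (ρ ∘P τ)) y ≡ fun π y
      undo-conjugation y =
        trans (swap-involutive a c _) (cong (fun π) (swap-involutive a c y))

    -- Induction over a support split as A ++ K, where π already fixes K:
    -- names of A that π fixes move to K, names that π moves are dropped.
    fixes-from-support : ∀ π → (∀ a → fun π a ≢ a → FreshBy R a x) →
                         ∀ A K → SupportedBy R (A ++ K) x → FixesAll π K → R π x x
    fixes-from-support π moved-fresh [] K supK fixesK = supK π fixesK
    fixes-from-support π moved-fresh (a ∷ A) K sup fixesK with fun π a ≟ a
    ... | yes πa≡a =
      fixes-from-support π moved-fresh A (a ∷ K)
        (λ σ fixes → sup σ (λ b → fixes b ∘ ∈-resp-↭ (↭-sym (shift a A K))))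
        (λ { b (here refl) → πa≡a ; b (there b∈K) → fixesK b b∈K })
    ... | no πa≢a =
      fixes-from-support π moved-fresh A K
        (drop-fresh sup (moved-fresh a πa≢a)
          (λ { b (here b≡a) b≢a → ⊥-elim (b≢a b≡a) ; b (there b∈) _ → b∈ }))
        fixesK

    moving-fresh-fixes : ∀ π → ∃[ A ] SupportedBy R A x →
                         (∀ a → fun π a ≢ a → FreshBy R a x) → R π x x
    moving-fresh-fixes π (A , supA) moved-fresh =
      fixes-from-support π moved-fresh A []
        (subst (λ B → SupportedBy R B x) (sym (++-identityʳ A)) supA) (λ _ ())

module LTransform {S : Sorting} (T : NTS S) (E : Effects T) (Lm : Eff.LMap T E) where
  open NTS T
  open Effects E
  open Eff T E
  open LMap Lm
  open Transform T E Lm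
  open Permutations S

  infixr 9 _·𝓕_ _·S_ _·A_
  _·𝓕_ : Perm S → 𝓕 → 𝓕
  _·𝓕_ = Nominal.act nomF
  _·S_ : Perm S → STATES → STATES
  _·S_ = Nominal.act nomS
  _·A_ : Perm S → ACT → ACT
  _·A_ = Nominal.act nomA

  -- Subsets of 𝓕 are predicates, so they are compared extensionally.
  infix 4 _≈_
  _≈_ : (𝓕 → Set) → (𝓕 → Set) → Set
  G ≈ H = ∀ h → G h ⇔ H h

  ≈-refl : ∀ {G} → G ≈ G
  ≈-refl h = ⇔-refl

  ≈-sym : ∀ {G H} → G ≈ H → H ≈ G
  ≈-sym G≈H h = ⇔-sym (G≈H h)

  ≈-trans : ∀ {G H K} → G ≈ H → H ≈ K → G ≈ K
  ≈-trans G≈H H≈K h = ⇔-trans (G≈H h) (H≈K h)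

  act-cancel : ∀ {X} (N : Nominal S X) (π σ : Perm S) → (∀ a → fun π (fun σ a) ≡ a) →
               ∀ x → Nominal.act N π (Nominal.act N σ x) ≡ x
  act-cancel N π σ π∘σ≗id x =
    trans (sym (Nominal.act-∘ N π σ x))
          (trans (Nominal.act-ext N (π ∘P σ) idP π∘σ≗id x) (Nominal.act-id N x))

  act-coherent : ∀ {X} (N : Nominal S X) x → Coherent (ActR N) x
  act-coherent N x = record
    { compose = λ π σ πx≡x σx≡x →
        trans (Nominal.act-∘ N π σ x) (trans (cong (Nominal.act N π) σx≡x) πx≡x)
    ; extensional = λ π σ π≗σ πx≡x → trans (sym (Nominal.act-ext N π σ π≗σ x)) πx≡x }

  subset-coherent : ∀ G → Coherent IsActP G
  subset-coherent G = record
    { compose = λ π σ πG≅G σG≅G h →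
        subst (λ k → G k ⇔ G h) (sym (Nominal.act-∘ nomF π σ h))
              (⇔-trans (πG≅G (σ ·𝓕 h)) (σG≅G h))
    ; extensional = λ π σ π≗σ πG≅G h →
        subst (λ k → G k ⇔ G h) (Nominal.act-ext nomF π σ π≗σ h) (πG≅G h) }

  fixes-element : ∀ {X} (N : Nominal S X) π x → (∀ a → fun π a ≢ a → Fresh N a x) →
                  Nominal.act N π x ≡ x
  fixes-element N π x =
    Support.moving-fresh-fixes (ActR N) x (act-coherent N x) π (Nominal.fin-supp N x)

  fixes-subset : ∀ π F → (∀ a → fun π a ≢ a → FreshPFS a F) → IsActP π (mem F) (mem F)
  fixes-subset π F =
    Support.moving-fresh-fixes IsActP (mem F) (subset-coherent (mem F)) π (fs F)

  image-unique : ∀ π G H H' → IsActP π G H → IsActP π G H' → H ≈ H'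
  image-unique π G H H' πG≅H πG≅H' h =
    subst (λ k → H k ⇔ H' k) (act-cancel nomF π (inverse π) (Perm.inv-r π) h)
      (⇔-trans (πG≅H (inverse π ·𝓕 h)) (⇔-sym (πG≅H' (inverse π ·𝓕 h))))

  identity-image : ∀ {G H} → G ≈ H → IsActP idP G H
  identity-image {G} {H} G≈H h =
    subst (λ k → H k ⇔ G h) (sym (Nominal.act-id nomF h)) (⇔-sym (G≈H h))

  fresh-weaken : ∀ {ℓ ℓ' r r'} {X : Set ℓ} {Y : Set ℓ'}
                   (R : Perm S → X → X → Set r) (R' : Perm S → Y → Y → Set r') {a x y} →
                 FreshBy R a x → (∀ π → R π x x → R' π y y) → FreshBy R' a y
  fresh-weaken _ _ (A , a∉A , supA) fixes⇒fixes =
    A , a∉A , λ π fixesA → fixes⇒fixes π (supA π fixesA)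

  fresh-resp-≈ : ∀ {G G' a} → G ≈ G' → FreshBy IsActP a G → FreshBy IsActP a G'
  fresh-resp-≈ G≈G' a#G = fresh-weaken IsActP IsActP a#G λ π πG≅G h →
    ⇔-trans (⇔-sym (G≈G' (π ·𝓕 h))) (⇔-trans (πG≅G h) (G≈G' h))

  L-resp : ∀ α G F f → mem G ≈ mem F → mem (L α G f) ≈ mem (L α F f)
  L-resp α G F f G≈F = ≈-sym (
    subst₂ (λ β g → mem (L β F g) ≈ mem (L α G f))
           (Nominal.act-id nomA α) (Nominal.act-id nomF f)
      (image-unique idP (mem (L α G f)) _ _ (L-eqv idP α G F f (identity-image G≈F))
                    (identity-image ≈-refl)))

  generated : ∀ {s β s'} → LGen s β s' → s ⟶L[ β ] s'
  generated {s} {β} {s'} step =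
    β , s' , step , idP , same-binders , (identity-label β , identity-state s') ,
    λ a _ moved → ⊥-elim (moved refl)
    where
    same-binders : SameSet (map (fun (idP {S})) (bnL β)) (bnL β)
    same-binders a = subst (λ ns → a ∈ ns ⇔ a ∈ bnL β) (sym (map-id (bnL β))) ⇔-refl
    identity-label : ∀ β → LActAR idP β β
    identity-label (inj₁ α) = Nominal.act-id nomA α
    identity-label (inj₂ f) = Nominal.act-id nomF f
    identity-state : ∀ s → LActR idP s s
    identity-state (AC f F P) =
      Nominal.act-id nomF f , identity-image ≈-refl , Nominal.act-id nomS P
    identity-state (EF F P)   = identity-image ≈-refl , Nominal.act-id nomS P

  fresh-AC : ∀ {a f F P} → Fresh nomF a f → FreshPFS a F → Fresh nomS a P →
             FreshBy LActR a (AC f F P)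
  fresh-AC {a} (A₁ , a∉A₁ , supA₁) (A₂ , a∉A₂ , supA₂) (A₃ , a∉A₃ , supA₃) =
    A₁ ++ A₂ ++ A₃ , a∉ ,
    λ π fixes → supA₁ π (λ b → fixes b ∘ ∈-++⁺ˡ) ,
                supA₂ π (λ b → fixes b ∘ ∈-++⁺ʳ A₁ ∘ ∈-++⁺ˡ) ,
                supA₃ π (λ b → fixes b ∘ ∈-++⁺ʳ A₁ ∘ ∈-++⁺ʳ A₂)
    where
    a∉ : a ∉ A₁ ++ A₂ ++ A₃
    a∉ a∈ with ∈-++⁻ A₁ a∈
    ... | inj₁ a∈A₁ = a∉A₁ a∈A₁
    ... | inj₂ a∈A₂₃ with ∈-++⁻ A₂ a∈A₂₃
    ...   | inj₁ a∈A₂ = a∉A₂ a∈A₂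
    ...   | inj₂ a∈A₃ = a∉A₃ a∈A₃

  -- The α-renaming has no binders to rename,
  -- so it moves only fresh names and fixes all components.
  effect-step-inv : ∀ F Q f t → EF F Q ⟶L[ inj₂ f ] t →
                    ∃[ F' ] (t ≡ AC f F' (app f Q) × mem F' ≈ mem F)
  effect-step-inv F Q f (AC f' F' Q')
      (inj₂ g , _ , ef _ , π , _ , (πg≡f , πg≡f' , πF≅F' , πgQ≡Q') , moved-fresh) =
    F' , cong₂ (λ h R → AC h F' R) f'≡f Q'≡fQ ,
    image-unique π (mem F) (mem F') (mem F) πF≅F' πF≅F
    where
    generator : LACT × LState
    generator = inj₂ g , AC g F (app g Q)
    -- π moves only names fresh for the generator, hence for its components.
    fresh-for : ∀ {ℓ} {Y : Set ℓ} (R : Perm S → Y → Y → Set) {y} →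
                (∀ τ → LPairR τ generator generator → R τ y y) →
                ∀ a → fun π a ≢ a → FreshBy R a y
    fresh-for R component a moved =
      fresh-weaken LPairR R {x = generator} (moved-fresh a (λ ()) moved) component
    πg≡g : π ·𝓕 g ≡ g
    πg≡g = fixes-element nomF π g (fresh-for (ActR nomF) (λ _ → proj₁))
    πF≅F : IsActP π (mem F) (mem F)
    πF≅F = fixes-subset π F (fresh-for IsActP (λ _ → proj₁ ∘ proj₂ ∘ proj₂))
    πgQ≡gQ : π ·S app g Q ≡ app g Q
    πgQ≡gQ =
      fixes-element nomS π (app g Q) (fresh-for (ActR nomS) (λ _ → proj₂ ∘ proj₂ ∘ proj₂))
    g≡f : g ≡ f
    g≡f = trans (sym πg≡g) πg≡f
    f'≡f : f' ≡ f
    f'≡f = trans (sym πg≡f') πg≡f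
    Q'≡fQ : Q' ≡ app f Q
    Q'≡fQ = trans (sym πgQ≡Q') (trans πgQ≡gQ (cong (λ h → app h Q) g≡f))

  FreshParams : 𝓕 → PFS → ℕ → Set
  FreshParams f F b = Fresh nomF b f × FreshPFS b F

  -- Then σ · L α₀ F₀ f ≈
  -- L (σ · α₀) F₀ f, although σ need not fix f or F₀: σ factors as
  -- transpositions of fresh binder names (which fix f and F₀, so commute
  -- with L by equivariance) followed by a permutation fixing α₀ and L α₀ F₀ f.
  module BinderRenaming (α₀ : ACT) (F₀ : PFS) (f : 𝓕)
                        (binders-fresh : ∀ b → b ∈ bn α₀ → FreshParams f F₀ b) where

    -- σ during the factorisation: the binders outside K are already fixed.
    record Renaming (K : List ℕ) (σ : Perm S) : Set where
      field
        fixes-settled    : ∀ b → b ∈ bn α₀ → b ∉ K → fun σ b ≡ b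
        moves-fresh      : ∀ a → a ∉ bn α₀ → fun σ a ≢ a →
                           Fresh nomA a α₀ × FreshPFS a (L α₀ F₀ f)
        binders-to-fresh : ∀ b → b ∈ bn α₀ → FreshParams f F₀ (fun σ b)
    open Renaming

    -- With every binder fixed, σ moves only fresh names of α₀ and of
    -- L α₀ F₀ f, hence fixes both.
    settled-image : ∀ σ → Renaming [] σ → ∀ G → IsActP σ (mem (L α₀ F₀ f)) G →
                    G ≈ mem (L (σ ·A α₀) F₀ f)
    settled-image σ ren G σX≅G =
      subst (λ β → G ≈ mem (L β F₀ f)) (sym σα₀≡α₀)
        (image-unique σ (mem (L α₀ F₀ f)) G (mem (L α₀ F₀ f)) σX≅G σX≅X)
      where
      moved-nonbinder : ∀ a → fun σ a ≢ a → a ∉ bn α₀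
      moved-nonbinder a moved a∈ = moved (fixes-settled ren a a∈ (λ ()))
      σα₀≡α₀ : σ ·A α₀ ≡ α₀
      σα₀≡α₀ = fixes-element nomA σ α₀ λ a moved →
        proj₁ (moves-fresh ren a (moved-nonbinder a moved) moved)
      σX≅X : IsActP σ (mem (L α₀ F₀ f)) (mem (L α₀ F₀ f))
      σX≅X = fixes-subset σ (L α₀ F₀ f) λ a moved →
        proj₂ (moves-fresh ren a (moved-nonbinder a moved) moved)

    settle-fixed : ∀ {k K σ} → Renaming (k ∷ K) σ → fun σ k ≡ k → Renaming K σ
    settle-fixed {k} {K} {σ} ren σk≡k = record
      { fixes-settled = fixes
      ; moves-fresh = moves-fresh ren
      ; binders-to-fresh = binders-to-fresh ren }
      where
      fixes : ∀ b → b ∈ bn α₀ → b ∉ K → fun σ b ≡ b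
      fixes b b∈ b∉K with b ≟ k
      ... | yes refl = σk≡k
      ... | no b≢k   =
        fixes-settled ren b b∈ λ { (here b≡k) → b≢k b≡k ; (there b∈K) → b∉K b∈K }

    -- A binder k moved by σ is settled by composing with κ = (k (σ k)).
    module SettleBySwap {k K σ} (ren : Renaming (k ∷ K) σ) (k∈ : k ∈ bn α₀)
                        (σk≢k : fun σ k ≢ k) where
      d : ℕ
      d = fun σ k

      κ : Perm S
      κ = transposition k d (sym (Perm.sort-pres σ k))

      -- κ exchanges two names fresh for (f , F₀), so it fixes f and F₀.
      κ-moves-fresh : ∀ a → fun κ a ≢ a → FreshParams f F₀ a
      κ-moves-fresh a moved with swap-moves k d a moved
      ... | inj₁ refl = binders-fresh k k∈
      ... | inj₂ refl = binders-to-fresh ren k k∈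

      κf≡f : κ ·𝓕 f ≡ f
      κf≡f = fixes-element nomF κ f (λ a → proj₁ ∘ κ-moves-fresh a)

      κF₀≅F₀ : IsActP κ (mem F₀) (mem F₀)
      κF₀≅F₀ = fixes-subset κ F₀ (λ a → proj₂ ∘ κ-moves-fresh a)

      κ-involutive : ∀ h → κ ·𝓕 (κ ·𝓕 h) ≡ h
      κ-involutive = act-cancel nomF κ κ (swap-involutive k d)

      settled : Renaming K (κ ∘P σ)
      settled = record
        { fixes-settled = fixes
        ; moves-fresh = moves
        ; binders-to-fresh = λ b b∈ →
            swap-preserves (FreshParams f F₀) k d (fun σ b)
              (binders-fresh k k∈) (binders-to-fresh ren k k∈) (binders-to-fresh ren b b∈) }
        where
        fixes : ∀ b → b ∈ bn α₀ → b ∉ K → swap k d (fun σ b) ≡ b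
        fixes b b∈ b∉K = by-cases (b ≟ k)
          where
          by-cases : Dec (b ≡ k) → swap k d (fun σ b) ≡ b
          by-cases (yes b≡k) = subst (λ y → swap k d (fun σ y) ≡ y) (sym b≡k) (swap-c k d)
          by-cases (no b≢k) =
            trans (cong (swap k d) σb≡b)
                  (swap-other k d b b≢k (b≢k ∘ fun-injective σ ∘ trans σb≡b))
            where
            σb≡b : fun σ b ≡ b
            σb≡b =
              fixes-settled ren b b∈ λ { (here b≡k) → b≢k b≡k ; (there b∈K) → b∉K b∈K }
        moves : ∀ a → a ∉ bn α₀ → swap k d (fun σ a) ≢ a →
                Fresh nomA a α₀ × FreshPFS a (L α₀ F₀ f)
        moves a a∉ moved with fun σ a ≟ a
        ... | no σa≢a = moves-fresh ren a a∉ σa≢a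
        ... | yes σa≡a with swap-moves k d a (moved ∘ trans (cong (swap k d) σa≡a))
        ...   | inj₁ refl = ⊥-elim (a∉ k∈)
        ...   | inj₂ refl = ⊥-elim (σk≢k (fun-injective σ σa≡a))

      shifted-image : ∀ G → IsActP σ (mem (L α₀ F₀ f)) G →
                      IsActP (κ ∘P σ) (mem (L α₀ F₀ f)) (G ∘ (κ ·𝓕_))
      shifted-image G σX≅G h =
        subst (λ k → G k ⇔ mem (L α₀ F₀ f) h)
          (sym (trans (cong (κ ·𝓕_) (Nominal.act-∘ nomF κ σ h)) (κ-involutive (σ ·𝓕 h))))
          (σX≅G h)

      -- Since κ fixes f and F₀, equivariance of L lets κ pass through L.
      κ-through-L : IsActP κ (mem (L (σ ·A α₀) F₀ f)) (mem (L ((κ ∘P σ) ·A α₀) F₀ f))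
      κ-through-L =
        subst₂ (λ β g → IsActP κ (mem (L (σ ·A α₀) F₀ f)) (mem (L β F₀ g)))
          (sym (Nominal.act-∘ nomA κ σ α₀)) κf≡f (L-eqv κ (σ ·A α₀) F₀ F₀ f κF₀≅F₀)

      unshift : ∀ G → (G ∘ (κ ·𝓕_)) ≈ mem (L ((κ ∘P σ) ·A α₀) F₀ f) →
                G ≈ mem (L (σ ·A α₀) F₀ f)
      unshift G shifted h =
        ⇔-trans (subst (λ k → G h ⇔ G k) (sym (κ-involutive h)) ⇔-refl)
                (⇔-trans (shifted (κ ·𝓕 h)) (κ-through-L h))

    renaming-image : ∀ K → (∀ k → k ∈ K → k ∈ bn α₀) → ∀ σ → Renaming K σ →
                     ∀ G → IsActP σ (mem (L α₀ F₀ f)) G → G ≈ mem (L (σ ·A α₀) F₀ f)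
    renaming-image [] _ σ ren = settled-image σ ren
    renaming-image (k ∷ K) K⊆bn σ ren G σX≅G with fun σ k ≟ k
    ... | yes σk≡k =
      renaming-image K (λ k' → K⊆bn k' ∘ there) σ (settle-fixed ren σk≡k) G σX≅G
    ... | no σk≢k  =
      unshift G (renaming-image K (λ k' → K⊆bn k' ∘ there) (κ ∘P σ) settled
                                (G ∘ (κ ·𝓕_)) (shifted-image G σX≅G))
      where open SettleBySwap ren (K⊆bn k (here refl)) σk≢k

  action-step-inv : ∀ {F₀ F' f Q α t} → mem F' ≈ mem F₀ →
                    (∀ a → a ∈ bn α → FreshParams f F₀ a) →
                    AC f F' Q ⟶L[ inj₁ α ] t →
                    ∃[ Q' ] (Q ⟶[ α ] Q' × ∃[ G ] (t ≡ EF G Q' × mem G ≈ mem (L α F₀ f)))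
  action-step-inv {F₀} {F'} {f} {Q} {α} {EF G Q'} F'≈F₀ α-fresh
      (inj₁ α₀ , EF _ Q₀ , ac {α = α₀} {P' = Q₀} step binders-fresh ,
       σ , same-binders , (σα₀≡α , σX≅G , σQ₀≡Q') , moved-fresh) =
    Q' , ⟶-α Q α₀ Q₀ α Q' renaming-in-T step , G , refl ,
    ≈-trans (subst (λ β → mem G ≈ mem (L β F' f)) σα₀≡α
              (renaming-image (bn α₀) (λ _ k∈ → k∈) σ σ-renaming (mem G) σX≅G))
            (L-resp α F' F₀ f F'≈F₀)
    where
    open BinderRenaming α₀ F' f binders-fresh
    generator : LACT × LState
    generator = inj₁ α₀ , EF (L α₀ F' f) Q₀
    renaming-in-T : AlphaEqBy (PairR nomA nomS) (bn α₀) (α₀ , Q₀) (bn α) (α , Q')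
    renaming-in-T = σ , same-binders , (σα₀≡α , σQ₀≡Q') , λ a a∉ moved →
      fresh-weaken LPairR (PairR nomA nomS) {x = generator} (moved-fresh a a∉ moved)
        (λ _ fixes → proj₁ fixes , proj₂ (proj₂ fixes))
    σ-renaming : Renaming (bn α₀) σ
    σ-renaming = record
      { fixes-settled = λ b b∈ b∉ → ⊥-elim (b∉ b∈)
      ; moves-fresh = λ a a∉ moved →
          fresh-weaken LPairR (ActR nomA) {x = generator} (moved-fresh a a∉ moved)
                       (λ _ → proj₁) ,
          fresh-weaken LPairR IsActP {x = generator} (moved-fresh a a∉ moved)
                       (λ _ → proj₁ ∘ proj₂)
      ; binders-to-fresh = λ b b∈ →
          let σb∈bnα = Equivalence.to (same-binders (fun σ b)) (∈-map⁺ (fun σ) b∈)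
              σb#f , σb#F₀ = α-fresh (fun σ b) σb∈bnα
          in σb#f , fresh-resp-≈ (≈-sym F'≈F₀) σb#F₀ }

  module Matching (R : LState → LState → Set₁) (isBisim : IsBisimL R) where

    effect-match : ∀ {F G₁ G₂ P Q} → mem G₁ ≈ mem F → mem G₂ ≈ mem F →
                   R (EF G₁ P) (EF G₂ Q) → ∀ f → mem F f →
                   ∃[ F' ] (mem F' ≈ mem F × R (AC f G₁ (app f P)) (AC f F' (app f Q)))
    effect-match {G₁ = G₁} {G₂ = G₂} {P = P} {Q = Q} G₁≈F G₂≈F r f f∈F
      with proj₂ (proj₂ isBisim _ _ r) (inj₂ f) (AC f G₁ (app f P)) (λ _ ())
                 (generated (ef (Equivalence.from (G₁≈F f) f∈F)))
    ... | t , step , r' with effect-step-inv G₂ Q f t step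
    ...   | F' , refl , F'≈G₂ = F' , ≈-trans F'≈G₂ G₂≈F , r'

    action-match : ∀ {F G₁ F' f P Q α P'} → mem G₁ ≈ mem F → mem F' ≈ mem F →
                   R (AC f G₁ P) (AC f F' Q) →
                   (∀ a → a ∈ bn α → Fresh nomS a Q × FreshPFS a F × Fresh nomF a f) →
                   P ⟶[ α ] P' →
                   ∃[ Q' ] (Q ⟶[ α ] Q' × ∃[ G ] (mem G ≈ mem (L α F f) ×
                                                  R (EF (L α G₁ f) P') (EF G Q')))
    action-match {F} {G₁} {F'} {f} {α = α} {P'} G₁≈F F'≈F r fresh step
      with proj₂ (proj₂ isBisim _ _ r) (inj₁ α) (EF (L α G₁ f) P')
                 (λ a a∈ → let a#Q , a#F , a#f = fresh a a∈
                           in fresh-AC {F = F'} a#f (fresh-resp-≈ (≈-sym F'≈F) a#F) a#Q)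
                 (generated (ac step λ a a∈ → let _ , a#F , a#f = fresh a a∈
                                              in a#f , fresh-resp-≈ (≈-sym G₁≈F) a#F))
    ... | t , step' , r'
      with action-step-inv {F₀ = F} F'≈F
             (λ a a∈ → let _ , a#F , a#f = fresh a a∈ in a#f , a#F) step'
    ...   | Q' , stepT , G , refl , G≈ = Q' , stepT , G , G≈ , r'

  EFBisimilar : PFS → STATES → STATES → Set₂
  EFBisimilar F P Q =
    ∃[ G₁ ] ∃[ G₂ ] (mem G₁ ≈ mem F × mem G₂ ≈ mem F × EF G₁ P ∼L EF G₂ Q)

  EFBisimilar-sym : ∀ F P Q → EFBisimilar F P Q → EFBisimilar F Q P
  EFBisimilar-sym F P Q (G₁ , G₂ , G₁≈F , G₂≈F , R , isBisim , r) =
    G₂ , G₁ , G₂≈F , G₁≈F , R , isBisim , proj₁ isBisim _ _ r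

  EFBisimilar-predicates : ∀ F P Q → EFBisimilar F P Q →
                           ∀ f → mem F f → ∀ φ → app f P ⊢ φ → app f Q ⊢ φ
  EFBisimilar-predicates F P Q (G₁ , G₂ , G₁≈F , G₂≈F , R , isBisim , r) f f∈F =
    let _ , _ , r' = effect-match {F = F} G₁≈F G₂≈F r f f∈F
    in proj₁ (proj₂ isBisim _ _ r')
    where open Matching R isBisim

  EFBisimilar-transitions :
    ∀ F P Q → EFBisimilar F P Q → ∀ f → mem F f → ∀ α P' →
    (∀ a → a ∈ bn α → Fresh nomS a (app f Q) × FreshPFS a F × Fresh nomF a f) →
    app f P ⟶[ α ] P' → ∃[ Q' ] (app f Q ⟶[ α ] Q' × EFBisimilar (L α F f) P' Q')
  EFBisimilar-transitions F P Q (G₁ , G₂ , G₁≈F , G₂≈F , R , isBisim , r)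
                          f f∈F α P' fresh step =
    let _ , F'≈F , r' = effect-match {F = F} G₁≈F G₂≈F r f f∈F
        Q' , stepT , G , G≈ , r'' = action-match {F = F} G₁≈F F'≈F r' fresh step
    in Q' , stepT , L α G₁ f , G , L-resp α G₁ F f G₁≈F , G≈ , R , isBisim , r''
    where open Matching R isBisim

  EFBisimilar-is-LBisim : IsLBisim EFBisimilar
  EFBisimilar-is-LBisim =
    EFBisimilar-sym ,
    λ F P Q related →
      EFBisimilar-predicates F P Q related , EFBisimilar-transitions F P Q related

theorem6p13 : {S : Sorting} (T : NTS S) (E : Effects T) (Lm : Eff.LMap T E) →
    let open Transform T E Lm in
    (F : Eff.PFS T E) (P Q : NTS.STATES T) →
    EF F P ∼L EF F Q → P ∼[ F /L] Q
theorem6p13 T E Lm F P Q bisimilar =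
  EFBisimilar , EFBisimilar-is-LBisim , (F , F , ≈-refl , ≈-refl , bisimilar)
  where open LTransform T E Lm
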